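{- For every string $v\in \Sigma^+$: (a) the longest string in $\Lambda(v)$ is $\mathrm{MaxSuf}^R(v)$, and $\Lambda(v)=\Lambda(\mathrm{MaxSuf}^R(v))$; (b) if $s$ is a suffix of $v$ such that $|v|\le 2|s|$, then $\Lambda(v)\subseteq \Lambda(s)\cup \{\mathrm{MaxSuf}^R(v)\}$.
   Context: $\Sigma$ is a totally ordered alphabet; $\prec$ denotes the lexicographic order (a proper prefix is smaller). $\prec^R$ is the lexicographic order obtained from the reversed order on letters of $\Sigma$ (again with a proper prefix smaller). $\mathrm{MaxSuf}^R(v)$ is the largest suffix of $v$ with respect to $\prec^R$. A Lyndon word is a non-empty string strictly smaller (w.r.t. $\prec$) than all its proper non-empty suffixes. Every $v\in\Sigma^+$ has a unique Lyndon factorization $v=v_1^{p_1}\cdots v_m^{p_m}$ with $p_j\ge1$ and Lyndon words $v_1\succ\cdots\succ v_m$. Set $s_j=v_j^{p_j}\cdots v_m^{p_m}$ for $1\le j\le m$ and $s_{m+1}=\varepsilon$. Let $\lambda$ be the smallest index such that $s_{i+1}$ is a prefix of $v_i$ for all $\lambda\le i\le m$. The set of significant suffixes is $\Lambda(v)=\{s_\lambda,s_{\lambda+1},\ldots,s_{m+1}\}$. -}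

module Defs where

open import Data.List using (List; []; _∷_; _++_; concat; replicate; length; drop; lookup)
open import Data.List.Relation.Binary.Lex.Strict using (Lex-<)
open import Data.List.Relation.Unary.Linked using (Linked)
open import Data.List.Relation.Unary.All using (All)
open import Data.Nat using (ℕ; suc; _≤_)
open import Data.Fin using (Fin; toℕ)
open import Data.Product using (Σ; _×_; ∃; proj₁; proj₂; _,_)
open import Data.Sum using (_⊎_)
open import Data.Empty using (⊥)
open import Function using (flip)
open import Relation.Binary.PropositionalEquality using (_≡_; _≢_)

module Strings {A : Set} (_<_ : A → A → Set) where

  _≺_ : List A → List A → Set
  _≺_ = Lex-< _≡_ _<_

  -- lexicographic order ≺^R from the reversed letter order (proper prefix smaller)
  _≺ᴿ_ : List A → List A → Set
  _≺ᴿ_ = Lex-< _≡_ (flip _<_)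

  IsSuffix : List A → List A → Set
  IsSuffix s v = ∃ λ u → u ++ s ≡ v

  IsPrefix : List A → List A → Set
  IsPrefix p w = ∃ λ u → p ++ u ≡ w

  IsMaxSufR : List A → List A → Set
  IsMaxSufR v m = IsSuffix m v × (∀ t → IsSuffix t v → t ≡ m ⊎ t ≺ᴿ m)

  Lyndon : List A → Set
  Lyndon w = w ≢ [] × (∀ u s → u ++ s ≡ w → u ≢ [] → s ≢ [] → w ≺ s)

  _^_ : List A → ℕ → List A
  w ^ p = concat (replicate p w)

  Factorization : Set
  Factorization = List (List A × ℕ)

  expand : Factorization → List A
  expand [] = []
  expand ((w , p) ∷ F) = (w ^ p) ++ expand F

  IsLyndonFactorization : List A → Factorization → Set
  IsLyndonFactorization v F =
    All (λ b → Lyndon (proj₁ b) × 1 ≤ proj₂ b) F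
    × Linked (λ b c → proj₁ c ≺ proj₁ b) F
    × expand F ≡ v

  V : (F : Factorization) → Fin (length F) → List A
  V F i = proj₁ (lookup F i)

  -- s_j = v_j^{p_j} ⋯ v_m^{p_m}; with 0-based indexing S F j is the paper's s_{j+1},
  -- and S F (length F) = ε is the paper's s_{m+1}
  S : Factorization → ℕ → List A
  S F j = expand (drop j F)

  Good : Factorization → ℕ → Set
  Good F j = (i : Fin (length F)) → j ≤ toℕ i → IsPrefix (S F (suc (toℕ i))) (V F i)

  IsLambda : Factorization → ℕ → Set
  IsLambda F l = l ≤ length F × Good F l × (∀ j → j ≤ length F → Good F j → l ≤ j)

  InΛ : Factorization → List A → Set
  InΛ F t = Σ ℕ λ l → IsLambda F l × (∃ λ j → l ≤ j × j ≤ length F × t ≡ S F j)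

module Submission where

-- Comparisons of words go through strict divergence a ⊏ b (at the first mismatch a has the
-- smaller letter), which survives appending and decides both ≺ and ≺ᴿ.  The key lemma, significant-index, is an induction on the factorization from its last
-- block: λ exists and s_λ is ≽ᴿ every suffix, i.e. s_λ = MaxSufᴿ(v).
--
-- (a) By uniqueness, the factorization of m = s_λ is the tail of F from λ on, whose own λ is 0,
--     so Λ(v) = Λ(m), and m is its longest element.
-- (b) Let j > λ.  If |s_λ| ≤ |s|, then s_λ = MaxSufᴿ(s) as well and (a) twice gives Λ(v) = Λ(s).
--     Otherwise |v| ≤ 2|s| forces s = w s_(λ+1) with w a non-empty suffix of v_λ^p_λ; the
--     factorization of s then ends with the blocks of s_(λ+1), so s_j stays significant in s.

open import Defs
open import Data.List using (List; []; _∷_; _++_; length; drop; [_]; initLast; _∷ʳ′_)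
open import Data.List.Properties
  using (++-assoc; ++-identityʳ; length-++; ∷-injective; ++-cancelˡ; ++-conicalˡ; ++-conicalʳ;
         length-++-≤ʳ; length-drop; drop-drop)
open import Data.List.Relation.Binary.Lex.Core using (halt; this; next)
open import Data.List.Relation.Binary.Lex.Strict using (Lex-<) renaming (<-isStrictTotalOrder to lex-isStrictTotalOrder)
open import Data.List.Relation.Unary.All as All using (All; []; _∷_)
import Data.List.Relation.Unary.All.Properties as AllP
open import Data.List.Relation.Unary.Linked as Linked using (Linked; []; [-]; _∷_)
open import Data.List.Relation.Binary.Pointwise using (Pointwise-≡⇒≡; ≡⇒Pointwise-≡)
open import Data.Nat using (ℕ; zero; suc; _+_; _*_; _∸_; _≤_; _<_; z≤n; s≤s)
open import Data.Nat.Properties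
  using (<-irrefl; ≤-refl; ≤-reflexive; ≤-trans; ≤-antisym; <-≤-trans; <⇒≤; ≰⇒>; ≤∧≢⇒<; n≤0⇒n≡0;
         _≟_; _≤?_; m≤m+n; m<m+n; +-comm; +-identityʳ; +-monoʳ-≤; +-monoˡ-<; *-cancelˡ-<;
         ∸-monoˡ-≤; m+[n∸m]≡n; module ≤-Reasoning)
open import Data.Fin using (zero; suc)
open import Data.Product using (Σ; _×_; ∃; ∃₂; proj₁; proj₂; _,_)
open import Data.Sum using (_⊎_; inj₁; inj₂)
open import Data.Empty using (⊥-elim)
open import Data.Unit using (⊤; tt)
open import Relation.Nullary using (¬_; Dec; yes; no)
open import Relation.Binary.PropositionalEquality
  using (_≡_; _≢_; refl; sym; trans; cong; cong₂; subst; module ≡-Reasoning)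
open import Relation.Binary.Structures using (IsStrictTotalOrder)
open import Relation.Binary.Definitions using (tri<; tri≈; tri>)
import Relation.Binary.Construct.Flip.EqAndOrd as Flip

module SignificantSuffixes {A : Set} (_<ₗ_ : A → A → Set) (sto : IsStrictTotalOrder _≡_ _<ₗ_) where
  open Strings _<ₗ_
  open IsStrictTotalOrder sto using ()
    renaming (trans to <ₗ-trans; irrefl to <ₗ-irrefl; compare to compareₗ; _≟_ to _≟ₗ_)

  <ₗ-irr : ∀ {x} → ¬ (x <ₗ x)
  <ₗ-irr = <ₗ-irrefl refl

  ++-split : ∀ (a b c d : List A) → a ++ b ≡ c ++ d →
    (∃ λ e → a ≡ c ++ e × d ≡ e ++ b) ⊎ (∃ λ e → c ≡ a ++ e × b ≡ e ++ d)
  ++-split []      b c       d eq = inj₂ (c , refl , eq)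
  ++-split (x ∷ a) b []      d eq = inj₁ (x ∷ a , refl , sym eq)
  ++-split (x ∷ a) b (y ∷ c) d eq with ∷-injective eq
  ... | refl , eq′ with ++-split a b c d eq′
  ...   | inj₁ (e , refl , q) = inj₁ (e , refl , q)
  ...   | inj₂ (e , refl , q) = inj₂ (e , refl , q)

  prefix-trans : ∀ {a b c} → IsPrefix a b → IsPrefix b c → IsPrefix a c
  prefix-trans {a} (z , refl) (z′ , refl) = z ++ z′ , sym (++-assoc a z z′)

  prefix-cancel : ∀ {a b} c → IsPrefix (c ++ a) (c ++ b) → IsPrefix a b
  prefix-cancel []      p       = p
  prefix-cancel (x ∷ c) (z , e) = prefix-cancel c (z , proj₂ (∷-injective e))

  suffix-trans : ∀ {a b c} → IsSuffix a b → IsSuffix b c → IsSuffix a c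
  suffix-trans {a} (u , refl) (u′ , refl) = u′ ++ u , ++-assoc u′ u a

  suffix-length : ∀ {a b} → IsSuffix a b → length a ≤ length b
  suffix-length {a} (u , refl) = length-++-≤ʳ a {u}

  no-longer-prefix : ∀ (e b : List A) → length (e ++ b) ≤ length b → e ≡ []
  no-longer-prefix []      b _  = refl
  no-longer-prefix (x ∷ e) b le = ⊥-elim (<-irrefl refl (≤-trans (s≤s (length-++-≤ʳ b {e})) le))

  no-longer-suffix : ∀ (b e : List A) → length (b ++ e) ≤ length b → e ≡ []
  no-longer-suffix b []      _  = refl
  no-longer-suffix b (x ∷ e) le =
    ⊥-elim (<-irrefl refl (≤-trans (subst (length b <_) (sym (length-++ b)) (m<m+n (length b) (s≤s z≤n))) le))

  suffix-by-length : ∀ {a b v} → IsSuffix a v → IsSuffix b v → length a ≤ length b → IsSuffix a b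
  suffix-by-length {a} {b} (ua , ea) (ub , eb) le with ++-split ua a ub b (trans ea (sym eb))
  ... | inj₁ (e , _ , q) = e , sym q
  ... | inj₂ (e , _ , refl) with no-longer-prefix e b le
  ...   | refl = [] , refl

  prefix-by-length : ∀ {a b v} → IsPrefix a v → IsPrefix b v → length a ≤ length b → IsPrefix a b
  prefix-by-length {a} {b} (za , ea) (zb , eb) le with ++-split a za b zb (trans ea (sym eb))
  ... | inj₂ (e , q , _) = e , sym q
  ... | inj₁ (e , refl , _) with no-longer-suffix b e le
  ...   | refl = [] , trans (++-identityʳ _) (++-identityʳ b)

  prefix-same-length : ∀ {a b} → IsPrefix a b → length a ≡ length b → a ≡ b
  prefix-same-length {a} (z , refl) eq with no-longer-suffix a z (≤-reflexive (sym eq))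
  ... | refl = sym (++-identityʳ a)

  suffix-of-++ : ∀ {t X Y} → IsSuffix t (X ++ Y) →
    IsSuffix t Y ⊎ (∃₂ λ w a → w ≢ [] × a ++ w ≡ X × t ≡ w ++ Y)
  suffix-of-++ {t} {X} {Y} (u , e) with ++-split u t X Y e
  ... | inj₁ (e′ , _ , q)       = inj₁ (e′ , sym q)
  ... | inj₂ ([] , _ , te)      = inj₁ ([] , te)
  ... | inj₂ (y ∷ e′ , xe , te) = inj₂ (y ∷ e′ , u , (λ ()) , sym xe , te)

  -- Unlike ≺ this is preserved by appending anything on either side, which is why all
  -- comparisons of words below go through it.
  infix 4 _⊏_
  data _⊏_ : List A → List A → Set where
    here  : ∀ {x y xs ys} → x <ₗ y → (x ∷ xs) ⊏ (y ∷ ys)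
    there : ∀ {a xs ys} → xs ⊏ ys → (a ∷ xs) ⊏ (a ∷ ys)

  ⊏-trans : ∀ {a b c} → a ⊏ b → b ⊏ c → a ⊏ c
  ⊏-trans (here p)  (here q)  = here (<ₗ-trans p q)
  ⊏-trans (here p)  (there q) = here p
  ⊏-trans (there p) (here q)  = here q
  ⊏-trans (there p) (there q) = there (⊏-trans p q)

  ⊏-apart : ∀ {a b} x y → a ⊏ b → a ++ x ≢ b ++ y
  ⊏-apart x y (here p)  e = <ₗ-irr (subst (_<ₗ _) (proj₁ (∷-injective e)) p)
  ⊏-apart x y (there m) e = ⊏-apart x y m (proj₂ (∷-injective e))

  ⊏-extendʳ : ∀ {a b c} → a ⊏ b → IsPrefix b c → a ⊏ c
  ⊏-extendʳ (here p)  (z , refl) = here p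
  ⊏-extendʳ (there m) (z , refl) = there (⊏-extendʳ m (z , refl))

  ⊏-extendˡ : ∀ {a b c} → a ⊏ b → IsPrefix a c → c ⊏ b
  ⊏-extendˡ (here p)  (z , refl) = here p
  ⊏-extendˡ (there m) (z , refl) = there (⊏-extendˡ m (z , refl))

  ⊏-++ʳ : ∀ {a b} c → a ⊏ b → a ⊏ b ++ c
  ⊏-++ʳ c m = ⊏-extendʳ m (c , refl)

  ⊏-++ˡ : ∀ {a b} c → a ⊏ b → a ++ c ⊏ b
  ⊏-++ˡ c m = ⊏-extendˡ m (c , refl)

  ⊏-cong : ∀ {a b} c → a ⊏ b → c ++ a ⊏ c ++ b
  ⊏-cong []      m = m
  ⊏-cong (x ∷ c) m = there (⊏-cong c m)

  ⊏-cancel : ∀ {a b} c → c ++ a ⊏ c ++ b → a ⊏ b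
  ⊏-cancel []      m         = m
  ⊏-cancel (x ∷ c) (here p)  = ⊥-elim (<ₗ-irr p)
  ⊏-cancel (x ∷ c) (there m) = ⊏-cancel c m

  ⊏-not-prefix : ∀ {a b} → a ⊏ b → ¬ IsPrefix b a
  ⊏-not-prefix {b = b} m (z , e) = ⊏-apart [] z m (trans (++-identityʳ _) (sym e))

  data Comparison (a b : List A) : Set where
    a⊏b    : a ⊏ b → Comparison a b
    b⊏a    : b ⊏ a → Comparison a b
    a-pref : IsPrefix a b → Comparison a b
    b-pref : IsPrefix b a → Comparison a b

  compare-words : ∀ a b → Comparison a b
  compare-words []      b       = a-pref (b , refl)
  compare-words (x ∷ a) []      = b-pref (x ∷ a , refl)
  compare-words (x ∷ a) (y ∷ b) with compareₗ x y
  ... | tri< p _ _ = a⊏b (here p)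
  ... | tri> _ _ p = b⊏a (here p)
  ... | tri≈ _ refl _ with compare-words a b
  ...   | a⊏b m        = a⊏b (there m)
  ...   | b⊏a m        = b⊏a (there m)
  ...   | a-pref (z , e) = a-pref (z , cong (x ∷_) e)
  ...   | b-pref (z , e) = b-pref (z , cong (x ∷_) e)

  private
    module Lex  = IsStrictTotalOrder (lex-isStrictTotalOrder sto)
    module LexR = IsStrictTotalOrder (lex-isStrictTotalOrder (Flip.isStrictTotalOrder sto))

  ≺-trans : ∀ {a b c} → a ≺ b → b ≺ c → a ≺ c
  ≺-trans = Lex.trans

  ≺-irrefl : ∀ {a} → ¬ (a ≺ a)
  ≺-irrefl = Lex.irrefl (≡⇒Pointwise-≡ refl)

  ≺ᴿ-trans : ∀ {a b c} → a ≺ᴿ b → b ≺ᴿ c → a ≺ᴿ c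
  ≺ᴿ-trans = LexR.trans

  ≺ᴿ-asym : ∀ {a b} → a ≺ᴿ b → ¬ (b ≺ᴿ a)
  ≺ᴿ-asym = LexR.asym

  ≺-trichotomy : ∀ a b → a ≺ b ⊎ a ≡ b ⊎ b ≺ a
  ≺-trichotomy a b with Lex.compare a b
  ... | tri< lt _ _ = inj₁ lt
  ... | tri≈ _ eq _ = inj₂ (inj₁ (Pointwise-≡⇒≡ eq))
  ... | tri> _ _ gt = inj₂ (inj₂ gt)

  ⊏⇒≺ : ∀ {a b} → a ⊏ b → a ≺ b
  ⊏⇒≺ (here p)  = this p
  ⊏⇒≺ (there m) = next refl (⊏⇒≺ m)

  ⊏⇒≻ᴿ : ∀ {a b} → a ⊏ b → b ≺ᴿ a
  ⊏⇒≻ᴿ (here p)  = this p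
  ⊏⇒≻ᴿ (there m) = next refl (⊏⇒≻ᴿ m)

  proper-prefix-lex : ∀ {R : A → A → Set} a {y zs} → Lex-< _≡_ R a (a ++ y ∷ zs)
  proper-prefix-lex []      = halt
  proper-prefix-lex (x ∷ a) = next refl (proper-prefix-lex a)

  shorter-prefix-lex : ∀ {R : A → A → Set} {a b} z → a ++ z ≡ b → length a < length b → Lex-< _≡_ R a b
  shorter-prefix-lex {a = a} []       refl lt rewrite ++-identityʳ a = ⊥-elim (<-irrefl refl lt)
  shorter-prefix-lex {a = a} (y ∷ zs) refl lt = proper-prefix-lex a

  ≺-cases : ∀ {a b} → a ≺ b → a ⊏ b ⊎ (∃₂ λ y zs → b ≡ a ++ y ∷ zs)
  ≺-cases halt = inj₂ (_ , _ , refl)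
  ≺-cases (this p) = inj₁ (here p)
  ≺-cases (next refl l) with ≺-cases l
  ... | inj₁ m                = inj₁ (there m)
  ... | inj₂ (y , zs , refl) = inj₂ (y , zs , refl)

  ≺-cong : ∀ {a b} c → a ≺ b → (c ++ a) ≺ (c ++ b)
  ≺-cong []      l = l
  ≺-cong (x ∷ c) l = next refl (≺-cong c l)

  ≺-not-prefix : ∀ {a b} → a ≺ b → ¬ IsPrefix b a
  ≺-not-prefix l p with ≺-cases l
  ≺-not-prefix l p          | inj₁ m = ⊏-not-prefix m p
  ≺-not-prefix {a} l (z , e) | inj₂ (y , zs , refl)
    with no-longer-suffix a (y ∷ zs ++ z) (≤-reflexive (cong length (trans (sym (++-assoc a (y ∷ zs) z)) e)))
  ... | ()

  -- A Lyndon word diverges strictly below each proper non-empty suffix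
  -- (being longer, it cannot be a proper prefix of one).
  lyndon-⊏-suffix : ∀ {ℓ} → Lyndon ℓ → ∀ u r → u ++ r ≡ ℓ → u ≢ [] → r ≢ [] → ℓ ⊏ r
  lyndon-⊏-suffix {ℓ} L u r e un rn with ≺-cases (proj₂ L u r e un rn)
  ... | inj₁ m = m
  ... | inj₂ (y , zs , eq) = ⊥-elim (<-irrefl refl (≤-trans longer shorter))
    where
    longer : length ℓ < length r
    longer = subst (length ℓ <_) (sym (trans (cong length eq) (length-++ ℓ))) (m<m+n (length ℓ) (s≤s z≤n))
    shorter : length r ≤ length ℓ
    shorter = subst (length r ≤_) (cong length e) (length-++-≤ʳ r {u})

  lyndon-⊏-suffix-of-suffix : ∀ {ℓ c u t} → Lyndon ℓ → c ++ u ≡ ℓ → c ≢ [] → IsSuffix t u → t ≢ [] → ℓ ⊏ t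
  lyndon-⊏-suffix-of-suffix {c = c} {t = t} L refl cn (b , refl) tn =
    lyndon-⊏-suffix L (c ++ b) t (++-assoc c b t) (λ e → cn (++-conicalˡ c b e)) tn

  lyndon-letter : ∀ a → Lyndon (a ∷ [])
  lyndon-letter a = (λ ()) , λ
    { []      s e un sn → ⊥-elim (un refl)
    ; (x ∷ u) s e un sn → ⊥-elim (sn (++-conicalʳ u s (proj₂ (∷-injective e)))) }

  lyndon-++ : ∀ {c l} → Lyndon c → Lyndon l → c ≺ l → Lyndon (c ++ l)
  lyndon-++ {c} {l} Lc Ll cl = (λ e → proj₁ Lc (++-conicalˡ c l e)) , below-suffixes
    where
    cl⊏l : c ++ l ⊏ l
    cl⊏l with ≺-cases cl
    ... | inj₁ m = ⊏-++ˡ l m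
    ... | inj₂ (y , zs , refl) = ⊏-cong c (lyndon-⊏-suffix Ll c (y ∷ zs) refl (proj₁ Lc) (λ ()))
    below-suffixes : ∀ u s → u ++ s ≡ c ++ l → u ≢ [] → s ≢ [] → (c ++ l) ≺ s
    below-suffixes u s eq un sn with ++-split u s c l eq
    ... | inj₁ ([] , _ , refl)      = ⊏⇒≺ cl⊏l
    ... | inj₁ (x ∷ e , _ , refl)   = ⊏⇒≺ (⊏-trans cl⊏l (lyndon-⊏-suffix Ll (x ∷ e) s refl (λ ()) sn))
    ... | inj₂ ([] , _ , refl)      = ⊏⇒≺ cl⊏l
    ... | inj₂ (x ∷ e , ceq , refl) =
          ⊏⇒≺ (⊏-++ʳ l (⊏-++ˡ l (lyndon-⊏-suffix Lc u (x ∷ e) (sym ceq) un (λ ()))))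

  pow-snoc : ∀ w p → w ^ suc p ≡ w ^ p ++ w
  pow-snoc w zero    = ++-identityʳ w
  pow-snoc w (suc p) = trans (cong (w ++_) (pow-snoc w p)) (sym (++-assoc w (w ^ p) w))

  pow-+ : ∀ w m n → w ^ (m + n) ≡ w ^ m ++ w ^ n
  pow-+ w zero    n = refl
  pow-+ w (suc m) n = trans (cong (w ++_) (pow-+ w m n)) (sym (++-assoc w (w ^ m) (w ^ n)))

  pow-comm : ∀ w m n → w ^ m ++ w ^ n ≡ w ^ n ++ w ^ m
  pow-comm w m n = trans (sym (pow-+ w m n)) (trans (cong (w ^_) (+-comm m n)) (pow-+ w n m))

  pow-prefix : ∀ ℓ p X → IsPrefix ℓ (ℓ ^ suc p ++ X)
  pow-prefix ℓ p X = ℓ ^ p ++ X , sym (++-assoc ℓ (ℓ ^ p) X)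

  data PowerSuffix (ℓ : List A) (p : ℕ) : List A → Set where
    whole   : ∀ q r → ℓ ^ p ≡ ℓ ^ r ++ ℓ ^ suc q → PowerSuffix ℓ p (ℓ ^ suc q)
    partial : ∀ c u q → c ≢ [] → u ≢ [] → c ++ u ≡ ℓ → PowerSuffix ℓ p (u ++ ℓ ^ q)

  suffix-in-first-copy : ∀ ℓ p a e′ → ℓ ≡ a ++ e′ → e′ ++ ℓ ^ p ≢ [] → PowerSuffix ℓ (suc p) (e′ ++ ℓ ^ p)
  suffix-in-first-copy ℓ p       []      _        refl _  = whole p 0 refl
  suffix-in-first-copy ℓ zero    (x ∷ a) []       _    wn = ⊥-elim (wn refl)
  suffix-in-first-copy ℓ (suc p) (x ∷ a) []       _    _  = whole p 1 (cong (_++ ℓ ^ suc p) (sym (++-identityʳ ℓ)))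
  suffix-in-first-copy ℓ p       (x ∷ a) (y ∷ e′) ℓe   _  = partial (x ∷ a) (y ∷ e′) p (λ ()) (λ ()) (sym ℓe)

  power-suffix : ∀ ℓ p a w → a ++ w ≡ ℓ ^ p → w ≢ [] → PowerSuffix ℓ p w
  power-suffix ℓ zero    a w e wn = ⊥-elim (wn (++-conicalʳ a w e))
  power-suffix ℓ (suc p) a w e wn with ++-split a w ℓ (ℓ ^ p) e
  ... | inj₂ (e′ , ℓ≡ae′ , refl) = suffix-in-first-copy ℓ p a e′ ℓ≡ae′ wn
  ... | inj₁ (e′ , refl , q) with power-suffix ℓ p e′ w (sym q) wn
  ...   | whole q r eq = whole q (suc r) (trans (cong (ℓ ++_) eq) (sym (++-assoc ℓ (ℓ ^ r) _)))
  ...   | partial c u q cn un cu = partial c u q cn un cu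

  Block : Set
  Block = List A × ℕ

  LyndonBlock : Block → Set
  LyndonBlock b = Lyndon (proj₁ b) × 1 ≤ proj₂ b

  Decreasing : Block → Block → Set
  Decreasing b c = proj₁ c ≺ proj₁ b

  LyndonSeq : Factorization → Set
  LyndonSeq F = All LyndonBlock F × Linked Decreasing F

  lyndonSeq-tail : ∀ {b F} → LyndonSeq (b ∷ F) → LyndonSeq F
  lyndonSeq-tail (_ ∷ ok , lk) = ok , Linked.tail lk

  lyndonSeq-drop : ∀ l {F} → LyndonSeq F → LyndonSeq (drop l F)
  lyndonSeq-drop zero    VF           = VF
  lyndonSeq-drop (suc l) {[]}    VF   = [] , []
  lyndonSeq-drop (suc l) {b ∷ F} VF   = lyndonSeq-drop l (lyndonSeq-tail VF)

  decreasing-reexp : ∀ {l p q F} → Linked Decreasing ((l , p) ∷ F) → Linked Decreasing ((l , q) ∷ F)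
  decreasing-reexp [-]      = [-]
  decreasing-reexp (r ∷ lk) = r ∷ lk

  below-head : ∀ {b F} → Linked Decreasing (b ∷ F) → All (λ c → proj₁ c ≺ proj₁ b) F
  below-head [-]      = []
  below-head (r ∷ lk) = r ∷ All.map (λ q → ≺-trans q r) (below-head lk)

  []≺ : ∀ {u} → u ≢ [] → [] ≺ u
  []≺ {[]}    un = ⊥-elim (un refl)
  []≺ {x ∷ u} _  = halt

  ≺-lyndon-++ : ∀ {u w X} → Lyndon u → w ≢ [] → w ≺ u → X ≺ u → (w ++ X) ≺ u
  ≺-lyndon-++ {u} {w} {X} Lu wn wu Xu with ≺-cases wu
  ... | inj₁ m = ⊏⇒≺ (⊏-++ˡ X m)
  ... | inj₂ (y , zs , refl) = ≺-cong w (≺-trans Xu (⊏⇒≺ (lyndon-⊏-suffix Lu w (y ∷ zs) refl wn (λ ()))))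

  ≺-lyndon-pow : ∀ {u w X} → Lyndon u → w ≢ [] → w ≺ u → ∀ p → X ≺ u → (w ^ p ++ X) ≺ u
  ≺-lyndon-pow Lu wn wu zero    Xu = Xu
  ≺-lyndon-pow {u} {w} {X} Lu wn wu (suc p) Xu =
    subst (_≺ u) (sym (++-assoc w (w ^ p) X)) (≺-lyndon-++ Lu wn wu (≺-lyndon-pow Lu wn wu p Xu))

  expand-below : ∀ {u F} → Lyndon u → All LyndonBlock F → All (λ c → proj₁ c ≺ u) F → expand F ≺ u
  expand-below Lu [] [] = []≺ (proj₁ Lu)
  expand-below {F = (w , p) ∷ F} Lu ((Lw , _) ∷ ok) (lt ∷ lts) = ≺-lyndon-pow Lu (proj₁ Lw) lt p (expand-below Lu ok lts)

  tail-below : ∀ {ℓ p F} → LyndonSeq ((ℓ , p) ∷ F) → expand F ≺ ℓ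
  tail-below ((Lℓ , _) ∷ ok , lk) = expand-below Lℓ ok (below-head lk)

  longest-lyndon-prefix : ∀ {u ℓ p F} → Lyndon u → LyndonSeq ((ℓ , p) ∷ F) →
    IsPrefix u (expand ((ℓ , p) ∷ F)) → length u ≤ length ℓ
  longest-lyndon-prefix {p = zero} Lu ((_ , ()) ∷ _ , _) pu
  longest-lyndon-prefix {u} {ℓ} {suc p} {F} Lu ((Lℓ , _) ∷ ok , lk) pu with length u ≤? length ℓ
  ... | yes le = le
  ... | no nle with prefix-by-length (pow-prefix ℓ p (expand F)) pu (<⇒≤ (≰⇒> nle))
  ...   | (r , refl) = ⊥-elim (≺-irrefl (≺-trans rest≺u (⊏⇒≺ u⊏rest)))
    where
    -- u = ℓ r diverges below its suffix r, which is a prefix of the rest ℓ^p F …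
    rest : List A
    rest = ℓ ^ p ++ expand F
    u⊏rest : ℓ ++ r ⊏ rest
    u⊏rest = ⊏-extendʳ (lyndon-⊏-suffix Lu ℓ r refl (proj₁ Lℓ) (λ { refl → nle (≤-reflexive (cong length (++-identityʳ ℓ))) }))
                       (prefix-cancel ℓ (subst (IsPrefix (ℓ ++ r)) (++-assoc ℓ (ℓ ^ p) (expand F)) pu))
    -- … yet that rest consists of factors below ℓ ≺ u.
    ℓ≺u : ℓ ≺ (ℓ ++ r)
    ℓ≺u = shorter-prefix-lex r refl (≰⇒> nle)
    rest≺u : rest ≺ (ℓ ++ r)
    rest≺u = ≺-lyndon-pow Lu (proj₁ Lℓ) ℓ≺u p (expand-below Lu ok (All.map (λ q → ≺-trans q ℓ≺u) (below-head lk)))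

  power-cancel : ∀ {ℓ X Y} p q → ℓ ^ p ++ X ≡ ℓ ^ q ++ Y → X ≺ ℓ → Y ≺ ℓ → p ≡ q × X ≡ Y
  power-cancel zero zero e _ _ = refl , e
  power-cancel {ℓ} {X} {Y} zero (suc q) e X≺ℓ _ =
    ⊥-elim (≺-not-prefix X≺ℓ (ℓ ^ q ++ Y , sym (trans e (++-assoc ℓ (ℓ ^ q) Y))))
  power-cancel {ℓ} {X} {Y} (suc p) zero e _ Y≺ℓ =
    ⊥-elim (≺-not-prefix Y≺ℓ (ℓ ^ p ++ X , trans (sym (++-assoc ℓ (ℓ ^ p) X)) e))
  power-cancel {ℓ} {X} {Y} (suc p) (suc q) e X≺ℓ Y≺ℓ
    with power-cancel p q (++-cancelˡ ℓ _ _ (trans (sym (++-assoc ℓ (ℓ ^ p) X)) (trans e (++-assoc ℓ (ℓ ^ q) Y)))) X≺ℓ Y≺ℓ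
  ... | refl , X≡Y = refl , X≡Y

  block-nonempty : ∀ {ℓ p G} → LyndonBlock (ℓ , p) → expand ((ℓ , p) ∷ G) ≢ []
  block-nonempty {[]}              (L , _)   _ = proj₁ L refl
  block-nonempty {x ∷ ℓ} {suc p}   _         ()

  first-factor-prefix : ∀ {ℓ p} F → LyndonBlock (ℓ , p) → IsPrefix ℓ (expand ((ℓ , p) ∷ F))
  first-factor-prefix {ℓ} {suc p} F _ = pow-prefix ℓ p (expand F)

  -- Each first factor is a Lyndon prefix of the other's word, hence no longer than it.
  same-first-factor : ∀ {ℓ p F ℓ′ p′ G} → LyndonSeq ((ℓ , p) ∷ F) → LyndonSeq ((ℓ′ , p′) ∷ G) →
    expand ((ℓ , p) ∷ F) ≡ expand ((ℓ′ , p′) ∷ G) → ℓ ≡ ℓ′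
  same-first-factor {ℓ} {p} {F} {ℓ′} {p′} {G} VF@((Lℓ , p≥1) ∷ _ , _) VG@((Lℓ′ , p′≥1) ∷ _ , _) e =
    prefix-same-length (prefix-by-length ℓ-prefix ℓ′-prefix ℓ≤ℓ′) (≤-antisym ℓ≤ℓ′ (longest-lyndon-prefix Lℓ′ VF ℓ′-prefix))
    where
    ℓ-prefix : IsPrefix ℓ (expand ((ℓ , p) ∷ F))
    ℓ-prefix = first-factor-prefix F (Lℓ , p≥1)
    ℓ′-prefix : IsPrefix ℓ′ (expand ((ℓ , p) ∷ F))
    ℓ′-prefix = subst (IsPrefix ℓ′) (sym e) (first-factor-prefix G (Lℓ′ , p′≥1))
    ℓ≤ℓ′ : length ℓ ≤ length ℓ′
    ℓ≤ℓ′ = longest-lyndon-prefix Lℓ VG (subst (IsPrefix ℓ) e ℓ-prefix)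

  lyndon-factorization-unique : ∀ F G → LyndonSeq F → LyndonSeq G → expand F ≡ expand G → F ≡ G
  lyndon-factorization-unique [] [] _ _ _ = refl
  lyndon-factorization-unique [] (b ∷ G) _ (okb ∷ _ , _) e = ⊥-elim (block-nonempty {G = G} okb (sym e))
  lyndon-factorization-unique (b ∷ F) [] (okb ∷ _ , _) _ e = ⊥-elim (block-nonempty {G = F} okb e)
  lyndon-factorization-unique ((ℓ , p) ∷ F) ((ℓ′ , p′) ∷ G) VF VG e with same-first-factor VF VG e
  ... | refl with power-cancel p p′ e (tail-below VF) (tail-below VG)
  ...   | refl , e′ with lyndon-factorization-unique F G (lyndonSeq-tail VF) (lyndonSeq-tail VG) e′
  ...     | refl = refl

  FactorizationOf : List A → Set
  FactorizationOf v = Σ Factorization λ F → LyndonSeq F × expand F ≡ v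

  -- Prepending c to a factorization starting with the
  -- block l^(p+1) raises the exponent (c = l), opens a new block (l ≺ c), or absorbs one copy
  -- of l into the Lyndon word c l and continues (c ≺ l).
  prepend : (c : List A) → Lyndon c → (F : Factorization) → LyndonSeq F → FactorizationOf (c ++ expand F)
  prepend-to-block : (c : List A) → Lyndon c → (l : List A) (p : ℕ) (F : Factorization) →
    LyndonSeq ((l , suc p) ∷ F) → FactorizationOf (c ++ expand ((l , suc p) ∷ F))
  absorb-copy : (c : List A) → Lyndon c → (l : List A) (p : ℕ) (F : Factorization) →
    LyndonSeq ((l , suc p) ∷ F) → c ≺ l → FactorizationOf (c ++ expand ((l , suc p) ∷ F))

  prepend c Lc [] _ = ((c , 1) ∷ []) , ((Lc , s≤s z≤n) ∷ [] , [-]) , ++-identityʳ (c ++ [])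
  prepend c Lc ((l , zero) ∷ F) ((_ , ()) ∷ _ , _)
  prepend c Lc ((l , suc p) ∷ F) V = prepend-to-block c Lc l p F V

  prepend-to-block c Lc l p F V@((Ll , p≥1) ∷ ok , lk) with ≺-trichotomy c l
  ... | inj₂ (inj₁ refl) =
        ((c , suc (suc p)) ∷ F) , ((Lc , s≤s z≤n) ∷ ok , decreasing-reexp lk) , ++-assoc c (c ^ suc p) (expand F)
  ... | inj₂ (inj₂ l≺c) =
        ((c , 1) ∷ (l , suc p) ∷ F) , ((Lc , s≤s z≤n) ∷ (Ll , p≥1) ∷ ok , l≺c ∷ lk) , cong (_++ _) (++-identityʳ c)
  ... | inj₁ c≺l = absorb-copy c Lc l p F V c≺l

  absorb-copy c Lc l zero F ((Ll , _) ∷ ok , lk) c≺l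
    with prepend (c ++ l) (lyndon-++ Lc Ll c≺l) F (ok , Linked.tail lk)
  ... | (H , VH , eH) =
        H , VH , trans eH (trans (++-assoc c l (expand F)) (cong (λ z → c ++ (z ++ expand F)) (sym (++-identityʳ l))))
  absorb-copy c Lc l (suc p) F ((Ll , _) ∷ ok , lk) c≺l
    with prepend-to-block (c ++ l) (lyndon-++ Lc Ll c≺l) l p F ((Ll , s≤s z≤n) ∷ ok , decreasing-reexp lk)
  ... | (H , VH , eH) =
        H , VH , trans eH (trans (++-assoc c l _) (cong (c ++_) (sym (++-assoc l (l ^ suc p) (expand F)))))

  lyndon-factorization-exists : ∀ v → FactorizationOf v
  lyndon-factorization-exists []      = [] , ([] , []) , refl
  lyndon-factorization-exists (a ∷ v) with lyndon-factorization-exists v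
  ... | (F , V , refl) = prepend (a ∷ []) (lyndon-letter a) F V

  S-suffix : ∀ l F → IsSuffix (S F l) (expand F)
  S-suffix zero    F             = [] , refl
  S-suffix (suc l) []            = [] , refl
  S-suffix (suc l) ((w , p) ∷ F) with S-suffix l F
  ... | (u , e) = w ^ p ++ u , trans (++-assoc (w ^ p) u _) (cong (w ^ p ++_) e)

  S-mono : ∀ F {l j} → l ≤ j → IsSuffix (S F j) (S F l)
  S-mono F       {zero}  {j}     _         = S-suffix j F
  S-mono []      {suc l} {suc j} _         = [] , refl
  S-mono (b ∷ F) {suc l} {suc j} (s≤s l≤j) = S-mono F l≤j

  S-drop : ∀ l j F → S (drop l F) j ≡ S F (l + j)
  S-drop l j F = cong expand (drop-drop l j F)

  good-tail : ∀ {b F j} → Good (b ∷ F) (suc j) → Good F j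
  good-tail g i le = g (suc i) (s≤s le)

  good-cons : ∀ {b F j} → Good F j → Good (b ∷ F) (suc j)
  good-cons g zero    ()
  good-cons g (suc i) (s≤s le) = g i le

  good-[] : ∀ {j} → Good [] j
  good-[] () _

  good-zero⁻ : ∀ {b F} → Good (b ∷ F) 0 → IsPrefix (expand F) (proj₁ b) × Good F 0
  good-zero⁻ g = g zero z≤n , λ i _ → g (suc i) z≤n

  good-zero⁺ : ∀ {b F} → IsPrefix (expand F) (proj₁ b) → Good F 0 → Good (b ∷ F) 0
  good-zero⁺ pre g zero    _ = pre
  good-zero⁺ pre g (suc i) _ = g i z≤n

  good-drop : ∀ l F → Good F l → Good (drop l F) 0
  good-drop zero    F       g = g
  good-drop (suc l) []      g = good-[]
  good-drop (suc l) (b ∷ F) g = good-drop l F (good-tail g)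

  good-++ : ∀ P {D j} → Good D j → Good (P ++ D) (length P + j)
  good-++ []      g = g
  good-++ (b ∷ P) g = good-cons (good-++ P g)

  lam-[] : IsLambda [] 0
  lam-[] = z≤n , good-[] , λ _ _ _ → z≤n

  lam-zero : ∀ {F} → Good F 0 → IsLambda F 0
  lam-zero g = z≤n , g , λ _ _ _ → z≤n

  lam-suc : ∀ {b F l} → IsLambda F l → ¬ Good (b ∷ F) 0 → IsLambda (b ∷ F) (suc l)
  lam-suc (le , g , least) ng = s≤s le , good-cons g , λ
    { zero    _         g0 → ⊥-elim (ng g0)
    ; (suc j) (s≤s j≤n) gj → s≤s (least j j≤n (good-tail gj)) }

  lam-unique : ∀ {F l l′} → IsLambda F l → IsLambda F l′ → l ≡ l′
  lam-unique (le , g , least) (le′ , g′ , least′) = ≤-antisym (least _ le′ g′) (least′ _ le g)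

  lam-good-zero : ∀ {F l} → IsLambda F l → Good F 0 → l ≡ 0
  lam-good-zero (_ , _ , least) g0 = n≤0⇒n≡0 (least 0 z≤n g0)

  lam-drop : ∀ {F l} → IsLambda F l → IsLambda (drop l F) 0
  lam-drop {F} {l} (_ , g , _) = lam-zero {drop l F} (good-drop l F g)

  prefix? : ∀ a b → Dec (IsPrefix a b)
  prefix? []      b       = yes (b , refl)
  prefix? (x ∷ a) []      = no λ { (_ , ()) }
  prefix? (x ∷ a) (y ∷ b) with x ≟ₗ y
  ... | no x≢y = no λ { (_ , e) → x≢y (proj₁ (∷-injective e)) }
  ... | yes refl with prefix? a b
  ...   | yes (z , e) = yes (z , cong (x ∷_) e)
  ...   | no ¬pre     = no λ { (z , e) → ¬pre (z , proj₂ (∷-injective e)) }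

  AboveSuffixes : List A → List A → Set
  AboveSuffixes v M = ∀ t → IsSuffix t v → t ≡ M ⊎ t ≺ᴿ M

  maxSufR-unique : ∀ {v m M} → IsMaxSufR v m → IsSuffix M v → AboveSuffixes v M → m ≡ M
  maxSufR-unique (m-suf , m-max) M-suf M-above with M-above _ m-suf | m-max _ M-suf
  ... | inj₁ m≡M | _        = m≡M
  ... | inj₂ _   | inj₁ M≡m = sym M≡m
  ... | inj₂ m≺M | inj₂ M≺m = ⊥-elim (≺ᴿ-asym m≺M M≺m)

  ⊏-≺-trans : ∀ {a b c} → a ⊏ b → b ≺ c → a ⊏ c
  ⊏-≺-trans m l with ≺-cases l
  ... | inj₁ m′               = ⊏-trans m m′
  ... | inj₂ (y , zs , refl) = ⊏-++ʳ (y ∷ zs) m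

  ⊏-≺-asym : ∀ {a b} → a ⊏ b → ¬ (b ≺ a)
  ⊏-≺-asym m l = ≺-irrefl (≺-trans (⊏⇒≺ m) l)

  data BlockSuffix (ℓ : List A) (p : ℕ) (E : List A) : List A → Set where
    in-tail : ∀ {t} → IsSuffix t E → BlockSuffix ℓ p E t
    power   : ∀ q r → ℓ ^ p ≡ ℓ ^ r ++ ℓ ^ suc q → BlockSuffix ℓ p E (ℓ ^ suc q ++ E)
    above   : ∀ {t} → ℓ ⊏ t → BlockSuffix ℓ p E t

  block-suffix : ∀ {ℓ p E t} → Lyndon ℓ → IsSuffix t (ℓ ^ p ++ E) → BlockSuffix ℓ p E t
  block-suffix {ℓ} {p} {E} Lℓ ts with suffix-of-++ ts
  ... | inj₁ ts′ = in-tail ts′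
  ... | inj₂ (w , a , wn , aw , refl) with power-suffix ℓ p a w aw wn
  ...   | whole q r eq           = power q r eq
  ...   | partial c u q cn un cu = above (⊏-++ʳ E (⊏-++ʳ (ℓ ^ q) (lyndon-⊏-suffix Lℓ c u cu cn un)))

  stays-maximal : ∀ {ℓ p E M} → Lyndon ℓ → AboveSuffixes E M → M ⊏ ℓ → AboveSuffixes (ℓ ^ p ++ E) M
  stays-maximal {ℓ} {p} {E} Lℓ max M⊏ℓ t ts with block-suffix {p = p} Lℓ ts
  ... | in-tail ts′ = max t ts′
  ... | power q r _ = inj₂ (⊏⇒≻ᴿ (⊏-extendʳ M⊏ℓ (pow-prefix ℓ q E)))
  ... | above ℓ⊏t   = inj₂ (⊏⇒≻ᴿ (⊏-trans M⊏ℓ ℓ⊏t))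

  pow-proper-prefix : ∀ {ℓ E y ys} → E ++ y ∷ ys ≡ ℓ → ∀ k r → (ℓ ^ k ++ E) ≺ᴿ (ℓ ^ k ++ ℓ ^ suc r ++ E)
  pow-proper-prefix {ℓ} {E} {y} {ys} pre k r = subst ((ℓ ^ k ++ E) ≺ᴿ_) eq (proper-prefix-lex (ℓ ^ k ++ E))
    where
    open ≡-Reasoning
    eq : (ℓ ^ k ++ E) ++ y ∷ ys ++ ℓ ^ r ++ E ≡ ℓ ^ k ++ ℓ ^ suc r ++ E
    eq = begin
      (ℓ ^ k ++ E) ++ y ∷ ys ++ ℓ ^ r ++ E   ≡⟨ ++-assoc (ℓ ^ k) E _ ⟩
      ℓ ^ k ++ E ++ y ∷ ys ++ ℓ ^ r ++ E     ≡⟨ cong (ℓ ^ k ++_) (sym (++-assoc E (y ∷ ys) _)) ⟩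
      ℓ ^ k ++ (E ++ y ∷ ys) ++ ℓ ^ r ++ E   ≡⟨ cong (λ z → ℓ ^ k ++ z ++ ℓ ^ r ++ E) pre ⟩
      ℓ ^ k ++ ℓ ++ ℓ ^ r ++ E               ≡⟨ cong (ℓ ^ k ++_) (sym (++-assoc ℓ (ℓ ^ r) E)) ⟩
      ℓ ^ k ++ ℓ ^ suc r ++ E                ∎

  becomes-maximal : ∀ {ℓ p E y ys} → Lyndon ℓ → 1 ≤ p → E ++ y ∷ ys ≡ ℓ → AboveSuffixes E E →
    AboveSuffixes (ℓ ^ p ++ E) (ℓ ^ p ++ E)
  becomes-maximal {ℓ} {suc p} {E} Lℓ _ pre max t ts with block-suffix {p = suc p} Lℓ ts
  ... | in-tail ts′ with max t ts′
  ...   | inj₁ refl = inj₂ (pow-proper-prefix pre 0 p)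
  ...   | inj₂ t≺E  = inj₂ (≺ᴿ-trans t≺E (pow-proper-prefix pre 0 p))
  becomes-maximal {ℓ} {suc p} {E} Lℓ _ pre max t ts | power q zero eq = inj₁ (cong (_++ E) (sym eq))
  becomes-maximal {ℓ} {suc p} {E} Lℓ _ pre max t ts | power q (suc r) eq =
    inj₂ (subst ((ℓ ^ suc q ++ E) ≺ᴿ_) reorder (pow-proper-prefix pre (suc q) r))
    where
    open ≡-Reasoning
    reorder : ℓ ^ suc q ++ ℓ ^ suc r ++ E ≡ ℓ ^ suc p ++ E
    reorder = begin
      ℓ ^ suc q ++ ℓ ^ suc r ++ E     ≡⟨ sym (++-assoc (ℓ ^ suc q) (ℓ ^ suc r) E) ⟩
      (ℓ ^ suc q ++ ℓ ^ suc r) ++ E   ≡⟨ cong (_++ E) (pow-comm ℓ (suc q) (suc r)) ⟩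
      (ℓ ^ suc r ++ ℓ ^ suc q) ++ E   ≡⟨ cong (_++ E) (sym eq) ⟩
      ℓ ^ suc p ++ E                  ∎
  becomes-maximal {ℓ} {suc p} {E} Lℓ _ pre max t ts | above ℓ⊏t =
    inj₂ (⊏⇒≻ᴿ (⊏-extendˡ ℓ⊏t (pow-prefix ℓ p E)))

  ⊏-of-prefix-below : ∀ {E X ℓ} → IsPrefix E X → X ≺ ℓ → ¬ IsPrefix E ℓ → E ⊏ ℓ
  ⊏-of-prefix-below {E} {X} {ℓ} E⊑X X≺ℓ ¬E⊑ℓ with compare-words ℓ E
  ... | a⊏b ℓ⊏E  = ⊥-elim (⊏-≺-asym (⊏-extendʳ ℓ⊏E E⊑X) X≺ℓ)
  ... | b⊏a E⊏ℓ  = E⊏ℓ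
  ... | a-pref ℓ⊑E = ⊥-elim (≺-not-prefix X≺ℓ (prefix-trans ℓ⊑E E⊑X))
  ... | b-pref E⊑ℓ = ⊥-elim (¬E⊑ℓ E⊑ℓ)

  -- If F is Good from 0 but expand F is not a prefix of ℓ, then expand F diverges below ℓ:
  -- expand F = x^p′ E′ with E′ a prefix of x is a prefix of x^(p′+1) ≺ ℓ.
  good-tail-⊏-head : ∀ {ℓ p F} → LyndonSeq ((ℓ , p) ∷ F) → Good F 0 → ¬ IsPrefix (expand F) ℓ → expand F ⊏ ℓ
  good-tail-⊏-head {F = []} _ _ ¬pre = ⊥-elim (¬pre (_ , refl))
  good-tail-⊏-head {ℓ} {F = (x , p′) ∷ F′} ((Lℓ , _) ∷ (Lx , _) ∷ _ , x≺ℓ ∷ _) g ¬pre =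
    ⊏-of-prefix-below E⊑xx (≺-lyndon-pow Lℓ (proj₁ Lx) x≺ℓ (suc p′) ([]≺ (proj₁ Lℓ))) ¬pre
    where
    open ≡-Reasoning
    E′⊑x : IsPrefix (expand F′) x
    E′⊑x = proj₁ (good-zero⁻ g)
    E⊑xx : IsPrefix (x ^ p′ ++ expand F′) (x ^ suc p′ ++ [])
    E⊑xx = proj₁ E′⊑x , (begin
      (x ^ p′ ++ expand F′) ++ proj₁ E′⊑x   ≡⟨ ++-assoc (x ^ p′) (expand F′) _ ⟩
      x ^ p′ ++ expand F′ ++ proj₁ E′⊑x     ≡⟨ cong (x ^ p′ ++_) (proj₂ E′⊑x) ⟩
      x ^ p′ ++ x                           ≡⟨ sym (pow-snoc x p′) ⟩
      x ^ suc p′                            ≡⟨ sym (++-identityʳ _) ⟩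
      x ^ suc p′ ++ []                      ∎)

  -- For λ ≠ 0, s_λ diverges below the first factor (recorded along the induction).
  BelowHead : Factorization → ℕ → Set
  BelowHead []      l = ⊤
  BelowHead (b ∷ F) l = l ≢ 0 → S (b ∷ F) l ⊏ proj₁ b

  tail-max-⊏-head : ∀ {ℓ p F l} → LyndonSeq ((ℓ , p) ∷ F) → IsLambda F l → l ≢ 0 → BelowHead F l → S F l ⊏ ℓ
  tail-max-⊏-head {F = []}    _              (l≤0 , _) l≢0 _     = ⊥-elim (l≢0 (n≤0⇒n≡0 l≤0))
  tail-max-⊏-head {F = _ ∷ _} (_ , x≺ℓ ∷ _) _          l≢0 below = ⊏-≺-trans (below l≢0) x≺ℓ

  record SignificantIndex (F : Factorization) : Set where
    constructor significant
    field
      index     : ℕ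
      isLambda  : IsLambda F index
      maximal   : AboveSuffixes (expand F) (S F index)
      belowHead : BelowHead F index

  index-step : ∀ {ℓ p F} → LyndonSeq ((ℓ , p) ∷ F) → (I : SignificantIndex F) →
    S F (SignificantIndex.index I) ⊏ ℓ → ¬ Good ((ℓ , p) ∷ F) 0 → SignificantIndex ((ℓ , p) ∷ F)
  index-step {p = p} ((Lℓ , _) ∷ _ , _) (significant l IL max _) M⊏ℓ ¬good =
    significant (suc l) (lam-suc IL ¬good) (stays-maximal {p = p} Lℓ max M⊏ℓ) (λ _ → M⊏ℓ)

  proper-prefix : ∀ {E ℓ} → IsPrefix E ℓ → E ≺ ℓ → ∃₂ λ y ys → E ++ y ∷ ys ≡ ℓ
  proper-prefix {E} ([] , e)     E≺ℓ = ⊥-elim (≺-irrefl (subst (E ≺_) (trans (sym e) (++-identityʳ E)) E≺ℓ))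
  proper-prefix     (y ∷ ys , e) _   = y , ys , e

  -- λ exists, and s_λ is ≽ᴿ every suffix.  Going from F to (ℓ,p) ∷ F, λ drops to 0 exactly
  -- when λ(F) = 0 and expand F is a prefix of ℓ; otherwise it increases by one.
  significant-index : ∀ F → LyndonSeq F → SignificantIndex F
  significant-index [] _ = significant 0 lam-[] (λ t (u , e) → inj₁ (++-conicalʳ u t e)) tt
  significant-index ((ℓ , p) ∷ F) V@((Lℓ , p≥1) ∷ _ , _) with significant-index F (lyndonSeq-tail V)
  ... | I@(significant l IL max below) with prefix? (expand F) ℓ | l ≟ 0
  ... | yes pre | yes refl = significant 0 (lam-zero good) whole-maximal (λ 0≢0 → ⊥-elim (0≢0 refl))
    where
    good : Good ((ℓ , p) ∷ F) 0
    good = good-zero⁺ pre (proj₁ (proj₂ IL))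
    whole-maximal : AboveSuffixes (ℓ ^ p ++ expand F) (ℓ ^ p ++ expand F)
    whole-maximal with proper-prefix pre (tail-below V)
    ... | (_ , _ , pre′) = becomes-maximal Lℓ p≥1 pre′ max
  ... | no ¬pre | yes refl =
        index-step V I (good-tail-⊏-head V (proj₁ (proj₂ IL)) ¬pre) (λ g → ¬pre (proj₁ (good-zero⁻ g)))
  ... | _ | no l≢0 =
        index-step V I (tail-max-⊏-head V IL l≢0 below) (λ g → l≢0 (lam-good-zero {F} IL (proj₂ (good-zero⁻ g))))

  Λ-intro : ∀ {F l j} → IsLambda F l → l ≤ j → j ≤ length F → InΛ F (S F j)
  Λ-intro IL l≤j j≤n = _ , IL , _ , l≤j , j≤n , refl

  Λ-elim : ∀ {F l t} → IsLambda F l → InΛ F t → ∃ λ j → l ≤ j × j ≤ length F × t ≡ S F j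
  Λ-elim {F} IL (l′ , IL′ , j , l′≤j , j≤n , e) = j , subst (_≤ j) (lam-unique {F} IL′ IL) l′≤j , j≤n , e

  Λ-drop⁺ : ∀ {F l t} → IsLambda F l → InΛ F t → InΛ (drop l F) t
  Λ-drop⁺ {F} {l} IL t∈Λ with Λ-elim {F} IL t∈Λ
  ... | j , l≤j , j≤n , refl =
    subst (InΛ (drop l F)) shift (Λ-intro (lam-drop {F} IL) z≤n (subst (j ∸ l ≤_) (sym (length-drop l F)) (∸-monoˡ-≤ l j≤n)))
    where
    shift : S (drop l F) (j ∸ l) ≡ S F j
    shift = trans (S-drop l (j ∸ l) F) (cong (S F) (m+[n∸m]≡n l≤j))

  Λ-drop⁻ : ∀ {F l t} → IsLambda F l → InΛ (drop l F) t → InΛ F t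
  Λ-drop⁻ {F} {l} IL t∈Λ with Λ-elim {drop l F} (lam-drop {F} IL) t∈Λ
  ... | j , _ , j≤n , refl = subst (InΛ F) (sym (S-drop l j F)) (Λ-intro IL (m≤m+n l j) l+j≤n)
    where
    l+j≤n : l + j ≤ length F
    l+j≤n = subst (l + j ≤_) (m+[n∸m]≡n (proj₁ IL)) (+-monoʳ-≤ l (subst (j ≤_) (length-drop l F) j≤n))

  PartA : List A → Factorization → Factorization → Set
  PartA m F G = (InΛ F m × (∀ t → InΛ F t → length t ≤ length m))
              × (∀ t → (InΛ F t → InΛ G t) × (InΛ G t → InΛ F t))

  -- Part (a): with G the factorization of m = MaxSufᴿ(expand F), m is s_λ (so it is the longest
  -- member of Λ(F)), G is the tail of F from λ on, and hence Λ(F) = Λ(G).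
  part-a : ∀ {F G m} → LyndonSeq F → IsMaxSufR (expand F) m → LyndonSeq G → expand G ≡ m → PartA m F G
  part-a {F} {G} VF mx VG eG with significant-index F VF
  ... | significant l IL max _ with maxSufR-unique mx (S-suffix l F) max
  ...   | refl with lyndon-factorization-unique (drop l F) G (lyndonSeq-drop l VF) VG (sym eG)
  ...     | refl = (Λ-intro IL ≤-refl (proj₁ IL) , longest) , λ t → Λ-drop⁺ {F} IL , Λ-drop⁻ {F} IL
    where
    longest : ∀ t → InΛ F t → length t ≤ length (S F l)
    longest t t∈Λ with Λ-elim {F} IL t∈Λ
    ... | j , l≤j , _ , refl = suffix-length (S-mono F l≤j)

  expand-++ : ∀ P Q → expand (P ++ Q) ≡ expand P ++ expand Q
  expand-++ []            Q = refl
  expand-++ ((w , p) ∷ P) Q = trans (cong (w ^ p ++_) (expand-++ P Q)) (sym (++-assoc (w ^ p) (expand P) (expand Q)))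

  S-++ : ∀ P {D} k → S (P ++ D) (length P + k) ≡ S D k
  S-++ []      k = refl
  S-++ (b ∷ P) k = S-++ P k

  -- If D is Good from 0, all its suffixes s_k stay significant in any Lyndon sequence Pre ++ D,
  -- since the index length Pre is Good there, so λ ≤ length Pre.
  Λ-of-extension : ∀ Pre {D} → LyndonSeq (Pre ++ D) → Good D 0 → ∀ k → k ≤ length D → InΛ (Pre ++ D) (S D k)
  Λ-of-extension Pre {D} V gD k k≤n with significant-index (Pre ++ D) V
  ... | significant l (l≤n , g , least) _ _ =
    subst (InΛ (Pre ++ D)) (S-++ Pre k) (Λ-intro (l≤n , g , least) (≤-trans l≤Pre (m≤m+n _ k)) Pre+k≤n)
    where
    l≤Pre : l ≤ length Pre
    l≤Pre = least (length Pre) (subst (length Pre ≤_) (sym (length-++ Pre)) (m≤m+n _ _))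
                  (subst (Good (Pre ++ D)) (+-identityʳ _) (good-++ Pre gD))
    Pre+k≤n : length Pre + k ≤ length (Pre ++ D)
    Pre+k≤n = subst (length Pre + k ≤_) (sym (length-++ Pre)) (+-monoʳ-≤ (length Pre) k≤n)

  powerBlock : List A → ℕ → Factorization
  powerBlock ℓ zero    = []
  powerBlock ℓ (suc q) = (ℓ , suc q) ∷ []

  powerBlock-seq : ∀ {ℓ l′ p D} q → LyndonSeq ((ℓ , p) ∷ D) → ℓ ≺ l′ →
    LyndonSeq (powerBlock ℓ q ++ D) × All (λ c → proj₁ c ≺ l′) (powerBlock ℓ q ++ D)
  powerBlock-seq zero    VB@(_ , lk) ℓ≺l′ = lyndonSeq-tail VB , All.map (λ c≺ℓ → ≺-trans c≺ℓ ℓ≺l′) (below-head lk)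
  powerBlock-seq (suc q) ((Lℓ , _) ∷ ok , lk) ℓ≺l′ =
    ((Lℓ , s≤s z≤n) ∷ ok , decreasing-reexp lk) , ℓ≺l′ ∷ All.map (λ c≺ℓ → ≺-trans c≺ℓ ℓ≺l′) (below-head lk)

  powerBlock-expand : ∀ ℓ q D → expand (powerBlock ℓ q ++ D) ≡ ℓ ^ q ++ expand D
  powerBlock-expand ℓ zero    D = refl
  powerBlock-expand ℓ (suc q) D = refl

  lyndonSeq-join : ∀ Us x C → LyndonSeq (Us ++ [ x ]) → LyndonSeq C → All (λ c → proj₁ c ≺ proj₁ x) C →
    LyndonSeq (Us ++ x ∷ C)
  lyndonSeq-join Us x C (okU , lkU) (okC , lkC) below =
    AllP.++⁺ (AllP.++⁻ˡ Us okU) (All.head (AllP.++⁻ʳ Us okU) ∷ okC) , join Us lkU (start below lkC)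
    where
    start : ∀ {C} → All (λ c → proj₁ c ≺ proj₁ x) C → Linked Decreasing C → Linked Decreasing (x ∷ C)
    start []      _  = [-]
    start (r ∷ _) lk = r ∷ lk
    join : ∀ Us → Linked Decreasing (Us ++ [ x ]) → Linked Decreasing (x ∷ C) → Linked Decreasing (Us ++ x ∷ C)
    join []           _         lk = lk
    join (y ∷ [])     (r ∷ _)   lk = r ∷ lk
    join (y ∷ z ∷ Us) (r ∷ lk₁) lk = r ∷ join (z ∷ Us) lk₁ lk

  last-factor-suffix : ∀ Us l′ r → 1 ≤ r → IsSuffix l′ (expand (Us ++ [ (l′ , r) ]))
  last-factor-suffix Us l′ (suc r) _ = expand Us ++ l′ ^ r , (begin
    (expand Us ++ l′ ^ r) ++ l′          ≡⟨ ++-assoc (expand Us) (l′ ^ r) l′ ⟩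
    expand Us ++ l′ ^ r ++ l′            ≡⟨ cong (expand Us ++_) (sym (pow-snoc l′ r)) ⟩
    expand Us ++ l′ ^ suc r              ≡⟨ cong (expand Us ++_) (sym (++-identityʳ _)) ⟩
    expand Us ++ (l′ ^ suc r ++ [])      ≡⟨ sym (expand-++ Us _) ⟩
    expand (Us ++ [ (l′ , suc r) ])      ∎)
    where open ≡-Reasoning

  -- The word u ℓ^q E, for u a non-empty proper suffix of ℓ and E = expand D.  The last factor l′
  -- of u is a proper suffix of ℓ, so ℓ ≺ l′; hence the factorization of u, then ℓ^q, then D is Lyndon.
  partial-extension : ∀ {ℓ p D c u} q → LyndonSeq ((ℓ , p) ∷ D) → c ≢ [] → u ≢ [] → c ++ u ≡ ℓ →
    ∃ λ Pre → LyndonSeq (Pre ++ D) × expand (Pre ++ D) ≡ (u ++ ℓ ^ q) ++ expand D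
  partial-extension {ℓ} {p} {D} {c} {u} q VB@((Lℓ , _) ∷ _ , _) cn un cu with lyndon-factorization-exists u
  ... | U , VU , eU with initLast U
  ...   | [] = ⊥-elim (un (sym eU))
  ...   | Us ∷ʳ′ (l′ , r) = Us ++ (l′ , r) ∷ powerBlock ℓ q , seq , spells
    where
    open ≡-Reasoning
    okl′ : LyndonBlock (l′ , r)
    okl′ = All.head (AllP.++⁻ʳ Us (proj₁ VU))
    ℓ≺l′ : ℓ ≺ l′
    ℓ≺l′ = ⊏⇒≺ (lyndon-⊏-suffix-of-suffix Lℓ cu cn (subst (IsSuffix l′) eU (last-factor-suffix Us l′ r (proj₂ okl′)))
                  (proj₁ (proj₁ okl′)))
    rest : LyndonSeq (powerBlock ℓ q ++ D) × All (λ b → proj₁ b ≺ l′) (powerBlock ℓ q ++ D)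
    rest = powerBlock-seq q VB ℓ≺l′
    reassoc : (Us ++ (l′ , r) ∷ powerBlock ℓ q) ++ D ≡ Us ++ (l′ , r) ∷ (powerBlock ℓ q ++ D)
    reassoc = ++-assoc Us ((l′ , r) ∷ powerBlock ℓ q) D
    seq : LyndonSeq ((Us ++ (l′ , r) ∷ powerBlock ℓ q) ++ D)
    seq = subst LyndonSeq (sym reassoc) (lyndonSeq-join Us (l′ , r) _ VU (proj₁ rest) (proj₂ rest))
    spells : expand ((Us ++ (l′ , r) ∷ powerBlock ℓ q) ++ D) ≡ (u ++ ℓ ^ q) ++ expand D
    spells = begin
      expand ((Us ++ (l′ , r) ∷ powerBlock ℓ q) ++ D)         ≡⟨ cong expand (trans reassoc (sym (++-assoc Us [ (l′ , r) ] _))) ⟩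
      expand ((Us ++ [ (l′ , r) ]) ++ powerBlock ℓ q ++ D)     ≡⟨ expand-++ (Us ++ [ (l′ , r) ]) _ ⟩
      expand (Us ++ [ (l′ , r) ]) ++ expand (powerBlock ℓ q ++ D) ≡⟨ cong₂ _++_ eU (powerBlock-expand ℓ q D) ⟩
      u ++ ℓ ^ q ++ expand D                                  ≡⟨ sym (++-assoc u (ℓ ^ q) (expand D)) ⟩
      (u ++ ℓ ^ q) ++ expand D                                ∎

  extension-factorization : ∀ {ℓ p D a w} → LyndonSeq ((ℓ , p) ∷ D) → a ++ w ≡ ℓ ^ p → w ≢ [] →
    ∃ λ Pre → LyndonSeq (Pre ++ D) × expand (Pre ++ D) ≡ w ++ expand D
  extension-factorization {ℓ} {p} {D} {a} {w} VB@((Lℓ , _) ∷ ok , lk) aw wn with power-suffix ℓ p a w aw wn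
  ... | whole q _ _            = [ (ℓ , suc q) ] , ((Lℓ , s≤s z≤n) ∷ ok , decreasing-reexp lk) , refl
  ... | partial c u q cn un cu = partial-extension q VB cn un cu

  starts-in-block : ∀ {ℓ p D s H} → LyndonSeq ((ℓ , p) ∷ D) → Good D 0 → IsSuffix s (ℓ ^ p ++ expand D) →
    length (expand D) < length s → LyndonSeq H → expand H ≡ s → ∀ k → k ≤ length D → InΛ H (S D k)
  starts-in-block {ℓ} {p} {D} VB gD ss E<s VH eH k k≤n with suffix-of-++ {X = ℓ ^ p} {Y = expand D} ss
  ... | inj₁ ss′ = ⊥-elim (<-irrefl refl (<-≤-trans E<s (suffix-length ss′)))
  ... | inj₂ (w , a , wn , aw , refl) with extension-factorization VB aw wn
  ...   | Pre , VP , eP with lyndon-factorization-unique (Pre ++ D) _ VP VH (trans eP (sym eH))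
  ...     | refl = Λ-of-extension Pre VP gD k k≤n

  -- Lengths for part (b): |s_(λ+1)| < |v_λ| and |v_λ| + |s_(λ+1)| ≤ |s_λ|, so |v| ≤ 2|s|
  -- forces |s_(λ+1)| < |s|.
  proper-prefix-length : ∀ {E ℓ : List A} {y ys} → E ++ y ∷ ys ≡ ℓ → length E < length ℓ
  proper-prefix-length {E} refl = subst (length E <_) (sym (length-++ E)) (m<m+n (length E) (s≤s z≤n))

  block-length : ∀ ℓ p E → 1 ≤ p → length ℓ + length E ≤ length (ℓ ^ p ++ E)
  block-length ℓ (suc p) E _ = begin
    length ℓ + length E               ≤⟨ +-monoʳ-≤ (length ℓ) (length-++-≤ʳ E {ℓ ^ p}) ⟩
    length ℓ + length (ℓ ^ p ++ E)    ≡⟨ sym (length-++ ℓ) ⟩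
    length (ℓ ++ ℓ ^ p ++ E)          ≡⟨ cong length (sym (++-assoc ℓ (ℓ ^ p) E)) ⟩
    length (ℓ ^ suc p ++ E)           ∎
    where open ≤-Reasoning

  half-bound : ∀ e l s → e < l → l + e ≤ 2 * s → e < s
  half-bound e l s e<l l+e≤2s =
    *-cancelˡ-< 2 e s (subst (_< 2 * s) (cong (e +_) (sym (+-identityʳ e))) (<-≤-trans (+-monoˡ-< e e<l) l+e≤2s))

  drop-cons : ∀ l (F : Factorization) → l < length F → ∃₂ λ b D → drop l F ≡ b ∷ D × drop (suc l) F ≡ D
  drop-cons zero    (b ∷ F) _         = b , F , refl , refl
  drop-cons (suc l) (b ∷ F) (s≤s l<n) = drop-cons l F l<n

  -- Part (b) for s_j, j > λ, when s is shorter than s_λ: by the length bound, s starts inside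
  -- the block v_λ^p_λ.
  part-b-starts-in-block : ∀ {F l H} → LyndonSeq F → IsLambda F l → IsSuffix (expand H) (expand F) →
    length (expand F) ≤ 2 * length (expand H) → length (expand H) < length (S F l) → LyndonSeq H →
    ∀ j → l < j → j ≤ length F → InΛ H (S F j)
  part-b-starts-in-block {F} {l} {H} VF IL ss v≤2s s<sλ VH j l<j j≤n with drop-cons l F (<-≤-trans l<j j≤n)
  ... | (ℓ , p) , D , eB , eD = subst (InΛ H) shift (starts-in-block VB gD ssB E<s VH refl (j ∸ suc l) k≤n)
    where
    VB : LyndonSeq ((ℓ , p) ∷ D)
    VB = subst LyndonSeq eB (lyndonSeq-drop l VF)
    gB : IsPrefix (expand D) ℓ × Good D 0
    gB = good-zero⁻ {ℓ , p} {D} (subst (λ X → Good X 0) eB (good-drop l F (proj₁ (proj₂ IL))))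
    gD : Good D 0
    gD = proj₂ gB
    sλ≡ : S F l ≡ ℓ ^ p ++ expand D
    sλ≡ = cong expand eB
    ssB : IsSuffix (expand H) (ℓ ^ p ++ expand D)
    ssB = subst (IsSuffix (expand H)) sλ≡ (suffix-by-length ss (S-suffix l F) (<⇒≤ s<sλ))
    E<s : length (expand D) < length (expand H)
    E<s = half-bound _ _ _ (proper-prefix-length (proj₂ (proj₂ (proper-prefix (proj₁ gB) (tail-below VB)))))
            (≤-trans (subst (λ z → length ℓ + length (expand D) ≤ length z) (sym sλ≡)
                       (block-length ℓ p (expand D) (proj₂ (All.head (proj₁ VB)))))
              (≤-trans (suffix-length (S-suffix l F)) v≤2s))
    k≤n : j ∸ suc l ≤ length D
    k≤n = subst (j ∸ suc l ≤_) (trans (sym (length-drop (suc l) F)) (cong length eD)) (∸-monoˡ-≤ (suc l) j≤n)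
    shift : S D (j ∸ suc l) ≡ S F j
    shift = trans (cong expand (cong (drop (j ∸ suc l)) (sym eD))) (trans (S-drop (suc l) (j ∸ suc l) F) (cong (S F) (m+[n∸m]≡n l<j)))

  -- Part (b) for s_j, j > λ.  If |s_λ| ≤ |s|, then s_λ is also MaxSufᴿ(s), and part (a) applied
  -- to v and to s gives Λ(v) = Λ(s_λ) = Λ(s).
  part-b-beyond : ∀ {F l H} → LyndonSeq F → IsLambda F l → AboveSuffixes (expand F) (S F l) →
    IsSuffix (expand H) (expand F) → length (expand F) ≤ 2 * length (expand H) → LyndonSeq H →
    ∀ j → l < j → j ≤ length F → InΛ H (S F j)
  part-b-beyond {F} {l} {H} VF IL max ss v≤2s VH j l<j j≤n with length (S F l) ≤? length (expand H)
  ... | no sλ≰s = part-b-starts-in-block VF IL ss v≤2s (≰⇒> sλ≰s) VH j l<j j≤n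
  ... | yes sλ≤s = Λs⊇ΛG (ΛG⊇Λv (Λ-intro IL (<⇒≤ l<j) j≤n))
    where
    VG : LyndonSeq (drop l F)
    VG = lyndonSeq-drop l VF
    max-v : IsMaxSufR (expand F) (S F l)
    max-v = S-suffix l F , max
    max-s : IsMaxSufR (expand H) (S F l)
    max-s = suffix-by-length (S-suffix l F) ss sλ≤s , λ t ts → max t (suffix-trans ts ss)
    ΛG⊇Λv : InΛ F (S F j) → InΛ (drop l F) (S F j)
    ΛG⊇Λv = proj₁ (proj₂ (part-a VF max-v VG refl) (S F j))
    Λs⊇ΛG : InΛ (drop l F) (S F j) → InΛ H (S F j)
    Λs⊇ΛG = proj₂ (proj₂ (part-a VH max-s VG refl) (S F j))

  part-b : ∀ {F s H m} → LyndonSeq F → IsMaxSufR (expand F) m → IsSuffix s (expand F) →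
    length (expand F) ≤ 2 * length s → LyndonSeq H → expand H ≡ s → ∀ t → InΛ F t → InΛ H t ⊎ t ≡ m
  part-b {F} VF mx ss v≤2s VH refl t t∈Λ with significant-index F VF
  ... | significant l IL max _ with maxSufR-unique mx (S-suffix l F) max | Λ-elim {F} IL t∈Λ
  ...   | refl | j , l≤j , j≤n , refl with l ≟ j
  ...     | yes refl = inj₂ refl
  ...     | no l≢j  = inj₁ (part-b-beyond VF IL max ss v≤2s VH j (≤∧≢⇒< l≤j l≢j) j≤n)

open SignificantSuffixes using (part-a; part-b)

corollary10 : {A : Set} (_<_ : A → A → Set) → IsStrictTotalOrder _≡_ _<_ →
    let open Strings _<_ in
    (v : List A) → v ≢ [] → (m : List A) → IsMaxSufR v m →
    (F : Factorization) → IsLyndonFactorization v F →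
    ((G : Factorization) → IsLyndonFactorization m G →
       (InΛ F m × (∀ t → InΛ F t → length t ≤ length m))
       × (∀ t → (InΛ F t → InΛ G t) × (InΛ G t → InΛ F t)))
    × ((s : List A) → IsSuffix s v → length v ≤ 2 * length s →
       (H : Factorization) → IsLyndonFactorization s H →
       ∀ t → InΛ F t → InΛ H t ⊎ t ≡ m)
corollary10 _<_ sto v _ m max-v F (okF , lkF , refl) =
  (λ G (okG , lkG , eG) → part-a _<_ sto (okF , lkF) max-v (okG , lkG) eG) ,
  (λ s s-suf v≤2s H (okH , lkH , eH) → part-b _<_ sto (okF , lkF) max-v s-suf v≤2s (okH , lkH) eH)
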